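{- Let $F(X)=X^3+a_1X^2+a_2X+a_3\in\mathbb{Z}[X]$ be irreducible and let $\alpha$ be a root of $F$. Let $I$ and $J$ be nonzero ideals of $\mathbb{Z}[\alpha]$, neither divisible by any rational integer (no integer $n\ge2$ with the ideal contained in $n\mathbb{Z}[\alpha]$), with $\gcd(N(I),N(J))=1$. Suppose $I$ has a $\mathbb{Z}$-basis $\{\alpha^2+(\mu_1+a_1)\alpha+\lambda,\ m_1\alpha-\mu_2m_1,\ m_1m_2\}$ and $J$ has a $\mathbb{Z}$-basis $\{\alpha^2+(\nu_1+a_1)\alpha+\lambda',\ n_1\alpha-\nu_2n_1,\ n_1n_2\}$, where $m_i,n_i$ are positive integers, $\lambda,\lambda',\mu_i,\nu_i$ are integers, $F(\mu_i)\equiv0\pmod{m_i}$, $F(\nu_i)\equiv 0\pmod{n_i}$ (so $N(I)=m_1^2m_2$ and $N(J)=n_1^2n_2$ are coprime). Let $\tilde\mu_1\bmod m_1n_1$ and $\tilde\mu_2\bmod m_2n_2$ be given by the Chinese remainder theorem: $\tilde\mu_1\equiv\mu_1\pmod{m_1}$, $\tilde\mu_1\equiv\nu_1\pmod{n_1}$, $\tilde\mu_2\equiv\mu_2\pmod{m_2}$, $\tilde\mu_2\equiv\nu_2\pmod{n_2}$. Then $IJ$ is not divisible by any rational integer, and $IJ$ has a $\mathbb{Z}$-basis $$\{\alpha^2+(\tilde\mu_1+a_1)\alpha+\tilde\lambda,\ \ m_1n_1\alpha-\tilde\mu_2m_1n_1,\ \ m_1n_1m_2n_2\}$$ for some integer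 $\tilde\lambda$. -}

module Defs where

open import Data.Integer using (ℤ; +_; _+_; _*_; -_; _-_; ∣_∣; _≤_; _<_)
open import Data.Integer.Divisibility using (_∣_)
open import Data.Nat using (ℕ)
open import Data.Product using (Σ; ∃; _×_; _,_; ∃-syntax)
open import Data.List using (List; []; _∷_)
open import Data.List.Relation.Unary.All using (All)
open import Relation.Binary.PropositionalEquality using (_≡_)
open import Relation.Nullary using (¬_)
open import Function.Bundles using (_⇔_)

record Cubic : Set where
  constructor cubic
  field
    a₁ a₂ a₃ : ℤ
open Cubic public

evalF : Cubic → ℤ → ℤ
evalF F x = x * x * x + a₁ F * x * x + a₂ F * x + a₃ F

-- Irreducibility of F in ℤ[X]: F is not a product G * H of two integer
-- polynomials of positive degree.  Since deg F = 3, such a factorization has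
-- degrees 1 and 2: G = g₀ + g₁X, H = h₀ + h₁X + h₂X² with g₁, h₂ ≠ 0,
-- and G * H = F coefficientwise.  (F is monic hence primitive, so units /
-- constant factors ±1 play no role.)
Irreducible : Cubic → Set
Irreducible F = ¬ (Σ ℤ λ g₀ → Σ ℤ λ g₁ → Σ ℤ λ h₀ → Σ ℤ λ h₁ → Σ ℤ λ h₂ →
      (g₁ * h₂ ≡ + 1)
    × (g₀ * h₂ + g₁ * h₁ ≡ a₁ F)
    × (g₀ * h₁ + g₁ * h₀ ≡ a₂ F)
    × (g₀ * h₀ ≡ a₃ F))

-- Elements of ℤ[α] ≅ ℤ[X]/(F), written c₀ + c₁ α + c₂ α² (power basis).
record Elt : Set where
  constructor ⟨_,_,_⟩
  field
    c₀ c₁ c₂ : ℤ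
open Elt public

zeroE : Elt
zeroE = ⟨ + 0 , + 0 , + 0 ⟩

oneE : Elt
oneE = ⟨ + 1 , + 0 , + 0 ⟩

_⊕_ : Elt → Elt → Elt
⟨ x₀ , x₁ , x₂ ⟩ ⊕ ⟨ y₀ , y₁ , y₂ ⟩ = ⟨ x₀ + y₀ , x₁ + y₁ , x₂ + y₂ ⟩

⊖_ : Elt → Elt
⊖ ⟨ x₀ , x₁ , x₂ ⟩ = ⟨ - x₀ , - x₁ , - x₂ ⟩

_·_ : ℤ → Elt → Elt
n · ⟨ x₀ , x₁ , x₂ ⟩ = ⟨ n * x₀ , n * x₁ , n * x₂ ⟩

-- Multiplication in ℤ[α], using α³ = -a₁α² - a₂α - a₃ and
-- α⁴ = (a₁² - a₂)α² + (a₁a₂ - a₃)α + a₁a₃.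
mul : Cubic → Elt → Elt → Elt
mul F ⟨ x₀ , x₁ , x₂ ⟩ ⟨ y₀ , y₁ , y₂ ⟩ =
  ⟨ d₀ - a₃ F * d₃ + a₁ F * a₃ F * d₄
  , d₁ - a₂ F * d₃ + (a₁ F * a₂ F - a₃ F) * d₄
  , d₂ - a₁ F * d₃ + (a₁ F * a₁ F - a₂ F) * d₄ ⟩
  where
  d₀ = x₀ * y₀
  d₁ = x₀ * y₁ + x₁ * y₀
  d₂ = x₀ * y₂ + x₁ * y₁ + x₂ * y₀
  d₃ = x₁ * y₂ + x₂ * y₁
  d₄ = x₂ * y₂

Subset : Set₁
Subset = Elt → Set

record IsIdeal (F : Cubic) (I : Subset) : Set where
  field
    has-zero : I zeroE
    closed-+ : ∀ x y → I x → I y → I (x ⊕ y)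
    closed-neg : ∀ x → I x → I (⊖ x)
    closed-mul : ∀ r x → I x → I (mul F r x)

NonzeroIdeal : Subset → Set
NonzeroIdeal I = Σ Elt λ x → I x × ¬ (x ≡ zeroE)

ContainedInMultiple : ℤ → Subset → Set
ContainedInMultiple n I = ∀ x → I x → Σ Elt λ y → x ≡ n · y

DivisibleByRationalInteger : Subset → Set
DivisibleByRationalInteger I = Σ ℤ λ n → (+ 2 ≤ n) × ContainedInMultiple n I

record Triple : Set where
  constructor [_,_,_]
  field
    b₁ b₂ b₃ : Elt
open Triple public

lincomb : ℤ → ℤ → ℤ → Triple → Elt
lincomb k₁ k₂ k₃ [ u , v , w ] = ((k₁ · u) ⊕ (k₂ · v)) ⊕ (k₃ · w)

IsZBasis : Subset → Triple → Set
IsZBasis I b =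
    (∀ x → I x ⇔ (Σ ℤ λ k₁ → Σ ℤ λ k₂ → Σ ℤ λ k₃ → x ≡ lincomb k₁ k₂ k₃ b))
  × (∀ k₁ k₂ k₃ → lincomb k₁ k₂ k₃ b ≡ zeroE →
       (k₁ ≡ + 0) × (k₂ ≡ + 0) × (k₃ ≡ + 0))

det : Triple → ℤ
det [ ⟨ p₀ , p₁ , p₂ ⟩ , ⟨ q₀ , q₁ , q₂ ⟩ , ⟨ r₀ , r₁ , r₂ ⟩ ] =
    p₀ * (q₁ * r₂ - q₂ * r₁)
  - p₁ * (q₀ * r₂ - q₂ * r₀)
  + p₂ * (q₀ * r₁ - q₁ * r₀)

-- The norm N(I) = [ℤ[α] : I] = |det b| for any ℤ-basis b of I.
HasNorm : Subset → ℕ → Set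
HasNorm I N = Σ Triple λ b → IsZBasis I b × (∣ det b ∣ ≡ N)

sumProducts : Cubic → List (Elt × Elt) → Elt
sumProducts F [] = zeroE
sumProducts F ((i , j) ∷ ps) = mul F i j ⊕ sumProducts F ps

ProductIdeal : Cubic → Subset → Subset → Subset
ProductIdeal F I J x =
  Σ (List (Elt × Elt)) λ ps →
    All (λ p → I (Data.Product.proj₁ p) × J (Data.Product.proj₂ p)) ps
    × (x ≡ sumProducts F ps)

_≡_[mod_] : ℤ → ℤ → ℤ → Set
a ≡ b [mod m ] = m ∣ (a - b)

normalBasis : Cubic → (μ₁ μ₂ lam m₁ m₂ : ℤ) → Triple
normalBasis F μ₁ μ₂ lam m₁ m₂ =
  [ ⟨ lam , μ₁ + a₁ F , + 1 ⟩
  , ⟨ - (μ₂ * m₁) , m₁ , + 0 ⟩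
  , ⟨ m₁ * m₂ , + 0 , + 0 ⟩ ]

-- The norm of an ideal with normal basis (μ₁, μ₂, λ, m₁, m₂) is divisible by m₁m₂, so coprime
-- norms give s m₁m₂ + t n₁n₂ = 1.  Since m₁m₂ ∈ I and n₁n₂ ∈ J, every x ∈ I ∩ J is
-- (s m₁m₂) x + x (t n₁n₂) ∈ IJ, hence IJ = I ∩ J.  Membership in such an ideal amounts to
-- m₁ ∣ vPart x and m₁m₂ ∣ wPart x, conditions which only see μ₁ mod m₁, μ₂ mod m₂ and a suitably
-- shifted λ mod m₁m₂.  Choosing λ̃ by the Chinese remainder theorem, the conditions for I and J
-- combine into those for the normal basis (μ̃₁, μ̃₂, λ̃, m₁n₁, m₂n₂).  Its first vector α² + ⋯
-- lies in IJ, so IJ is not contained in n ℤ[α] for any n ≥ 2.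
module Submission where

open import Data.Empty using (⊥-elim)
open import Data.Integer using (ℤ; +_; _+_; _*_; -_; _-_; _<_; +≤+) renaming (∣_∣ to abs)
open import Data.Integer.Divisibility.Signed
import Data.Integer.Properties as ℤ
open import Data.Integer.Tactic.RingSolver using (solve-∀; solve)
open import Data.List using (_∷_; [])
open import Data.List.Relation.Unary.All using (All)
open import Data.Nat using (ℕ)
import Data.Nat as ℕ
open import Data.Nat.GCD using (gcd; gcd-GCD; GCD; module Bézout)
import Data.Nat.Properties as ℕ
open import Data.Product using (Σ; _×_; _,_; proj₁; proj₂)
open import Data.Product.Function.NonDependent.Propositional using (_×-⇔_)
open import Data.Sum using ([_,_]′)
open import Function.Base using (id; _∘_)
open import Function.Bundles using (_⇔_; mk⇔; Equivalence)
import Function.Properties.Equivalence as ⇔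
open import Level using (0ℓ)
import Relation.Binary.Reasoning.Setoid as SetoidReasoning
open import Relation.Binary.PropositionalEquality
  using (_≡_; _≢_; refl; sym; trans; cong; cong₂; subst; ≢-sym; module ≡-Reasoning)
open import Relation.Nullary using (¬_)

open import Defs

bézout⇒∣m∣n⇒∣m*n : ∀ {a b z} s t → s * a + t * b ≡ + 1 → a ∣ z → b ∣ z → a * b ∣ z
bézout⇒∣m∣n⇒∣m*n {a} {b} s t bézout (divides p refl) (divides q eq) = divides (s * q + t * p) (begin
  p * a                              ≡⟨ sym (ℤ.*-identityʳ (p * a)) ⟩
  p * a * + 1                        ≡⟨ cong (p * a *_) (sym bézout) ⟩
  p * a * (s * a + t * b)            ≡⟨ solve (p ∷ a ∷ s ∷ t ∷ b ∷ []) ⟩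
  s * a * (p * a) + t * b * (p * a)  ≡⟨ cong (λ y → s * a * y + t * b * (p * a)) eq ⟩
  s * a * (q * b) + t * b * (p * a)  ≡⟨ solve (s ∷ a ∷ q ∷ b ∷ t ∷ p ∷ []) ⟩
  (s * q + t * p) * (a * b)          ∎)
  where open ≡-Reasoning

*-pres-∣ : ∀ {i j a b} → i ∣ a → j ∣ b → i * j ∣ a * b
*-pres-∣ {i} {j} (divides p refl) (divides q refl) = divides (p * q) (solve (p ∷ i ∷ q ∷ j ∷ []))

crt : (s t a b X Y : ℤ) → ℤ
crt s t a b X Y = t * b * X + s * a * Y

crt≡ˡ : ∀ {a b} s t X Y → s * a + t * b ≡ + 1 → a ∣ crt s t a b X Y - X
crt≡ˡ {a} {b} s t X Y bézout = divides (s * (Y - X)) (begin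
  t * b * X + s * a * Y - X                  ≡⟨ solve (t ∷ b ∷ X ∷ s ∷ a ∷ Y ∷ []) ⟩
  s * (Y - X) * a + X * (s * a + t * b) - X  ≡⟨ cong (λ u → s * (Y - X) * a + X * u - X) bézout ⟩
  s * (Y - X) * a + X * + 1 - X              ≡⟨ solve (s ∷ Y ∷ X ∷ a ∷ []) ⟩
  s * (Y - X) * a                            ∎)
  where open ≡-Reasoning

crt≡ʳ : ∀ {a b} s t X Y → s * a + t * b ≡ + 1 → b ∣ crt s t a b X Y - Y
crt≡ʳ {a} {b} s t X Y bézout = divides (t * (X - Y)) (begin
  t * b * X + s * a * Y - Y                  ≡⟨ solve (t ∷ b ∷ X ∷ s ∷ a ∷ Y ∷ []) ⟩
  t * (X - Y) * b + Y * (s * a + t * b) - Y  ≡⟨ cong (λ u → t * (X - Y) * b + Y * u - Y) bézout ⟩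
  t * (X - Y) * b + Y * + 1 - Y              ≡⟨ solve (t ∷ X ∷ Y ∷ b ∷ []) ⟩
  t * (X - Y) * b                            ∎)
  where open ≡-Reasoning

ℕ-identity⇒ℤ : ∀ x y a b → 1 ℕ.+ y ℕ.* b ≡ x ℕ.* a → + 1 + + y * + b ≡ + x * + a
ℕ-identity⇒ℤ x y a b eq =
  trans (cong (_+_ (+ 1)) (sym (ℤ.pos-* y b))) (trans (cong +_ eq) (ℤ.pos-* x a))

bézout-ℤ : ∀ {a b} → gcd a b ≡ 1 → Σ ℤ λ s → Σ ℤ λ t → s * + a + t * + b ≡ + 1
bézout-ℤ {a} {b} gcd≡1 with Bézout.identity (subst (GCD a b) gcd≡1 (gcd-GCD a b))
... | Bézout.+- x y eq = + x , - + y , cancel (+ y) (+ b) (ℕ-identity⇒ℤ x y a b eq)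
  where
  cancel : ∀ {u} v w → + 1 + v * w ≡ u → u + - v * w ≡ + 1
  cancel v w refl = solve (v ∷ w ∷ [])
... | Bézout.-+ x y eq = - + x , + y , cancel (+ x) (+ a) (ℕ-identity⇒ℤ y x b a eq)
  where
  cancel : ∀ {u} v w → + 1 + v * w ≡ u → - v * w + u ≡ + 1
  cancel v w refl = solve (v ∷ w ∷ [])

bézout-∣ : ∀ {a b c d} → (Σ ℤ λ s → Σ ℤ λ t → s * a + t * b ≡ + 1) → c ∣ a → d ∣ b →
           Σ ℤ λ s → Σ ℤ λ t → s * c + t * d ≡ + 1
bézout-∣ {c = c} {d} (s , t , bézout) (divides p refl) (divides q refl) =
  s * p , t * q , trans regroup bézout
  where
  regroup : s * p * c + t * q * d ≡ s * (p * c) + t * (q * d)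
  regroup = solve (s ∷ p ∷ c ∷ t ∷ q ∷ d ∷ [])

⟨⟩-cong : ∀ {x₀ x₁ x₂ y₀ y₁ y₂} → x₀ ≡ y₀ → x₁ ≡ y₁ → x₂ ≡ y₂ → ⟨ x₀ , x₁ , x₂ ⟩ ≡ ⟨ y₀ , y₁ , y₂ ⟩
⟨⟩-cong refl refl refl = refl

⊕-identityʳ : ∀ x → x ⊕ zeroE ≡ x
⊕-identityʳ ⟨ x₀ , x₁ , x₂ ⟩ = ⟨⟩-cong (ℤ.+-identityʳ x₀) (ℤ.+-identityʳ x₁) (ℤ.+-identityʳ x₂)

·-identityˡ : ∀ x → (+ 1) · x ≡ x
·-identityˡ ⟨ x₀ , x₁ , x₂ ⟩ = ⟨⟩-cong (ℤ.*-identityˡ x₀) (ℤ.*-identityˡ x₁) (ℤ.*-identityˡ x₂)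

·-distribʳ : ∀ a b x → (a · x) ⊕ (b · x) ≡ (a + b) · x
·-distribʳ a b ⟨ x₀ , x₁ , x₂ ⟩ =
  ⟨⟩-cong (sym (ℤ.*-distribʳ-+ x₀ a b)) (sym (ℤ.*-distribʳ-+ x₁ a b)) (sym (ℤ.*-distribʳ-+ x₂ a b))

mul-comm : ∀ F x y → mul F x y ≡ mul F y x
mul-comm F ⟨ x₀ , x₁ , x₂ ⟩ ⟨ y₀ , y₁ , y₂ ⟩ =
  ⟨⟩-cong (comm₀ (a₁ F) (a₃ F)) (comm₁ (a₁ F) (a₂ F) (a₃ F)) (comm₂ (a₁ F) (a₂ F))
  where
  comm₀ : ∀ a₁ a₃ →
    x₀ * y₀ - a₃ * (x₁ * y₂ + x₂ * y₁) + a₁ * a₃ * (x₂ * y₂) ≡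
    y₀ * x₀ - a₃ * (y₁ * x₂ + y₂ * x₁) + a₁ * a₃ * (y₂ * x₂)
  comm₀ a₁ a₃ = solve (a₁ ∷ a₃ ∷ x₀ ∷ x₁ ∷ x₂ ∷ y₀ ∷ y₁ ∷ y₂ ∷ [])
  comm₁ : ∀ a₁ a₂ a₃ →
    x₀ * y₁ + x₁ * y₀ - a₂ * (x₁ * y₂ + x₂ * y₁) + (a₁ * a₂ - a₃) * (x₂ * y₂) ≡
    y₀ * x₁ + y₁ * x₀ - a₂ * (y₁ * x₂ + y₂ * x₁) + (a₁ * a₂ - a₃) * (y₂ * x₂)
  comm₁ a₁ a₂ a₃ = solve (a₁ ∷ a₂ ∷ a₃ ∷ x₀ ∷ x₁ ∷ x₂ ∷ y₀ ∷ y₁ ∷ y₂ ∷ [])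
  comm₂ : ∀ a₁ a₂ →
    x₀ * y₂ + x₁ * y₁ + x₂ * y₀ - a₁ * (x₁ * y₂ + x₂ * y₁) + (a₁ * a₁ - a₂) * (x₂ * y₂) ≡
    y₀ * x₂ + y₁ * x₁ + y₂ * x₀ - a₁ * (y₁ * x₂ + y₂ * x₁) + (a₁ * a₁ - a₂) * (y₂ * x₂)
  comm₂ a₁ a₂ = solve (a₁ ∷ a₂ ∷ x₀ ∷ x₁ ∷ x₂ ∷ y₀ ∷ y₁ ∷ y₂ ∷ [])

mul-constˡ : ∀ F n x → mul F ⟨ n , + 0 , + 0 ⟩ x ≡ n · x
mul-constˡ F n ⟨ x₀ , x₁ , x₂ ⟩ =
  ⟨⟩-cong (const₀ (a₁ F) (a₃ F)) (const₁ (a₁ F) (a₂ F) (a₃ F)) (const₂ (a₁ F) (a₂ F))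
  where
  const₀ : ∀ a₁ a₃ → n * x₀ - a₃ * (+ 0 * x₂ + + 0 * x₁) + a₁ * a₃ * (+ 0 * x₂) ≡ n * x₀
  const₀ a₁ a₃ = solve (a₁ ∷ a₃ ∷ n ∷ x₀ ∷ x₁ ∷ x₂ ∷ [])
  const₁ : ∀ a₁ a₂ a₃ →
    n * x₁ + + 0 * x₀ - a₂ * (+ 0 * x₂ + + 0 * x₁) + (a₁ * a₂ - a₃) * (+ 0 * x₂) ≡ n * x₁
  const₁ a₁ a₂ a₃ = solve (a₁ ∷ a₂ ∷ a₃ ∷ n ∷ x₀ ∷ x₁ ∷ x₂ ∷ [])
  const₂ : ∀ a₁ a₂ →
    n * x₂ + + 0 * x₁ + + 0 * x₀ - a₁ * (+ 0 * x₂ + + 0 * x₁) + (a₁ * a₁ - a₂) * (+ 0 * x₂) ≡ n * x₂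
  const₂ a₁ a₂ = solve (a₁ ∷ a₂ ∷ n ∷ x₀ ∷ x₁ ∷ x₂ ∷ [])

mul-constʳ : ∀ F n x → mul F x ⟨ n , + 0 , + 0 ⟩ ≡ n · x
mul-constʳ F n x = trans (mul-comm F x _) (mul-constˡ F n x)

∋-const-multiple : ∀ {F P a} → IsIdeal F P → ∀ n → P ⟨ a , + 0 , + 0 ⟩ → P ⟨ n * a , + 0 , + 0 ⟩
∋-const-multiple {F} {P} {a} isP n a∈P =
  subst P (trans (mul-constˡ F n _) (cong₂ (λ u v → ⟨ n * a , u , v ⟩) (ℤ.*-zeroʳ n) (ℤ.*-zeroʳ n)))
    (IsIdeal.closed-mul isP ⟨ n , + 0 , + 0 ⟩ _ a∈P)

module _ {F : Cubic} {I J : Subset} (isI : IsIdeal F I) (isJ : IsIdeal F J) where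

  open IsIdeal
  open import Data.List.Relation.Unary.All using (_∷_; [])

  ProductIdeal⊆∩ : ∀ {x} → ProductIdeal F I J x → I x × J x
  ProductIdeal⊆∩ (ps , all , refl) = sum∈ all
    where
    sum∈ : ∀ {ps} → All (λ p → I (proj₁ p) × J (proj₂ p)) ps → I (sumProducts F ps) × J (sumProducts F ps)
    sum∈ [] = has-zero isI , has-zero isJ
    sum∈ {(i , j) ∷ _} ((i∈I , j∈J) ∷ rest) =
      closed-+ isI _ _ (subst I (mul-comm F j i) (closed-mul isI j i i∈I)) (proj₁ (sum∈ rest)) ,
      closed-+ isJ _ _ (closed-mul isJ i j j∈J) (proj₂ (sum∈ rest))

  -- x = (s a) x + x (t b) writes an element of I ∩ J as a sum of products.
  ProductIdeal⇔∩ : ∀ {a b} s t → I ⟨ a , + 0 , + 0 ⟩ → J ⟨ b , + 0 , + 0 ⟩ → s * a + t * b ≡ + 1 →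
                   ∀ x → ProductIdeal F I J x ⇔ (I x × J x)
  ProductIdeal⇔∩ {a} {b} s t a∈I b∈J bézout x = mk⇔ ProductIdeal⊆∩ ∩⊆ProductIdeal
    where
    sa = ⟨ s * a , + 0 , + 0 ⟩
    tb = ⟨ t * b , + 0 , + 0 ⟩
    decomposition : mul F sa x ⊕ (mul F x tb ⊕ zeroE) ≡ x
    decomposition = begin
      mul F sa x ⊕ (mul F x tb ⊕ zeroE)  ≡⟨ cong₂ _⊕_ (mul-constˡ F (s * a) x)
                                                    (trans (⊕-identityʳ _) (mul-constʳ F (t * b) x)) ⟩
      ((s * a) · x) ⊕ ((t * b) · x)      ≡⟨ ·-distribʳ (s * a) (t * b) x ⟩
      (s * a + t * b) · x                ≡⟨ cong (_· x) bézout ⟩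
      (+ 1) · x                          ≡⟨ ·-identityˡ x ⟩
      x                                  ∎
      where open ≡-Reasoning
    ∩⊆ProductIdeal : I x × J x → ProductIdeal F I J x
    ∩⊆ProductIdeal (x∈I , x∈J) =
      (sa , x) ∷ (x , tb) ∷ [] ,
      (∋-const-multiple isI s a∈I , x∈J) ∷ (x∈I , ∋-const-multiple isJ t b∈J) ∷ [] ,
      sym decomposition

∋c₂≡1⇒¬Divisible : ∀ {P x} → P x → c₂ x ≡ + 1 → ¬ DivisibleByRationalInteger P
∋c₂≡1⇒¬Divisible {x = x} x∈P c₂≡1 (+ k , +≤+ 2≤k , P⊆k) with P⊆k x x∈P
... | y , refl =
  ℕ.<⇒≢ 2≤k (sym (ℕ.m*n≡1⇒m≡1 k (abs (c₂ y)) (trans (sym (ℤ.abs-* (+ k) (c₂ y))) (cong abs c₂≡1))))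

basis-members : ∀ {P u v w} → IsZBasis P [ u , v , w ] → P u × P v × P w
basis-members {P} {u} {v} {w} (spans , _) =
  member (+ 1) (+ 0) (+ 0)
    (⟨⟩-cong (e₁ (c₀ u) (c₀ v) (c₀ w)) (e₁ (c₁ u) (c₁ v) (c₁ w)) (e₁ (c₂ u) (c₂ v) (c₂ w))) ,
  member (+ 0) (+ 1) (+ 0)
    (⟨⟩-cong (e₂ (c₀ u) (c₀ v) (c₀ w)) (e₂ (c₁ u) (c₁ v) (c₁ w)) (e₂ (c₂ u) (c₂ v) (c₂ w))) ,
  member (+ 0) (+ 0) (+ 1)
    (⟨⟩-cong (e₃ (c₀ u) (c₀ v) (c₀ w)) (e₃ (c₁ u) (c₁ v) (c₁ w)) (e₃ (c₂ u) (c₂ v) (c₂ w)))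
  where
  member : ∀ {x} k₁ k₂ k₃ → x ≡ lincomb k₁ k₂ k₃ [ u , v , w ] → P x
  member {x} k₁ k₂ k₃ eq = Equivalence.from (spans x) (k₁ , k₂ , k₃ , eq)
  e₁ : ∀ a b c → a ≡ + 1 * a + + 0 * b + + 0 * c
  e₁ = solve-∀
  e₂ : ∀ a b c → b ≡ + 0 * a + + 1 * b + + 0 * c
  e₂ = solve-∀
  e₃ : ∀ a b c → c ≡ + 0 * a + + 0 * b + + 1 * c
  e₃ = solve-∀

i*j≡0∧j≢0⇒i≡0 : ∀ {i j} → i * j ≡ + 0 → j ≢ + 0 → i ≡ + 0
i*j≡0∧j≢0⇒i≡0 {i} eq j≢0 = [ id , ⊥-elim ∘ j≢0 ]′ (ℤ.i*j≡0⇒i≡0∨j≡0 i eq)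

i≢0∧j≢0⇒i*j≢0 : ∀ {i j} → i ≢ + 0 → j ≢ + 0 → i * j ≢ + 0
i≢0∧j≢0⇒i*j≢0 {i} i≢0 j≢0 eq = [ i≢0 , j≢0 ]′ (ℤ.i*j≡0⇒i≡0∨j≡0 i eq)

addToFirstColumn : (a b : ℤ) → Elt → Elt
addToFirstColumn a b x = ⟨ c₀ x + a * c₁ x + b * c₂ x , c₁ x , c₂ x ⟩

det-addToFirstColumn : ∀ a b x y z →
  det [ addToFirstColumn a b x , addToFirstColumn a b y , addToFirstColumn a b z ] ≡ det [ x , y , z ]
det-addToFirstColumn a b ⟨ x₀ , x₁ , x₂ ⟩ ⟨ y₀ , y₁ , y₂ ⟩ ⟨ z₀ , z₁ , z₂ ⟩ = begin
  (x₀ + a * x₁ + b * x₂) * (y₁ * z₂ - y₂ * z₁)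
    - x₁ * ((y₀ + a * y₁ + b * y₂) * z₂ - y₂ * (z₀ + a * z₁ + b * z₂))
    + x₂ * ((y₀ + a * y₁ + b * y₂) * z₁ - y₁ * (z₀ + a * z₁ + b * z₂))
    ≡⟨ solve (a ∷ b ∷ x₀ ∷ x₁ ∷ x₂ ∷ y₀ ∷ y₁ ∷ y₂ ∷ z₀ ∷ z₁ ∷ z₂ ∷ []) ⟩
  x₀ * (y₁ * z₂ - y₂ * z₁) - x₁ * (y₀ * z₂ - y₂ * z₀) + x₂ * (y₀ * z₁ - y₁ * z₀)
    ∎
  where open ≡-Reasoning

∣column₀⇒∣det : ∀ {k x y z} → k ∣ c₀ x → k ∣ c₀ y → k ∣ c₀ z → k ∣ det [ x , y , z ]
∣column₀⇒∣det {x = ⟨ _ , x₁ , x₂ ⟩} {⟨ _ , y₁ , y₂ ⟩} {⟨ _ , z₁ , z₂ ⟩} k∣x₀ k∣y₀ k∣z₀ =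
  ∣m∣n⇒∣m+n (∣m∣n⇒∣m-n (∣m⇒∣m*n _ k∣x₀) (∣n⇒∣m*n x₁ (∣m∣n⇒∣m-n (∣m⇒∣m*n z₂ k∣y₀) (∣n⇒∣m*n y₂ k∣z₀))))
            (∣n⇒∣m*n x₂ (∣m∣n⇒∣m-n (∣m⇒∣m*n z₁ k∣y₀) (∣n⇒∣m*n y₁ k∣z₀)))

-- Writing x = k₁ u + k₂ v + k₃ w in the basis [u , v , w] = normalBasis F μ₁ μ₂ lam m₁ m₂
-- gives k₁ = c₂ x, k₂ m₁ = vPart F μ₁ x and k₃ m₁ m₂ = wPart F μ₁ μ₂ lam x.
vPart : Cubic → ℤ → Elt → ℤ
vPart F μ₁ x = c₁ x - c₂ x * (μ₁ + a₁ F)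

wPart : Cubic → (μ₁ μ₂ lam : ℤ) → Elt → ℤ
wPart F μ₁ μ₂ lam x = c₀ x - c₂ x * lam + μ₂ * vPart F μ₁ x

record InNormalLattice (F : Cubic) (μ₁ μ₂ lam m₁ m₂ : ℤ) (x : Elt) : Set where
  constructor parts-divisible
  field
    m₁∣vPart   : m₁ ∣ vPart F μ₁ x
    m₁m₂∣wPart : m₁ * m₂ ∣ wPart F μ₁ μ₂ lam x

module _ (F : Cubic) (μ₁ μ₂ lam m₁ m₂ : ℤ) where

  private
    nb : Triple
    nb = normalBasis F μ₁ μ₂ lam m₁ m₂

  lincomb-normalBasis-parts : ∀ k₁ k₂ k₃ → let x = lincomb k₁ k₂ k₃ nb in
    c₂ x ≡ k₁ × vPart F μ₁ x ≡ k₂ * m₁ × wPart F μ₁ μ₂ lam x ≡ k₃ * (m₁ * m₂)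
  lincomb-normalBasis-parts k₁ k₂ k₃ = c₂-part , v-part (μ₁ + a₁ F) , w-part (μ₁ + a₁ F)
    where
    c₂-part : k₁ * + 1 + k₂ * + 0 + k₃ * + 0 ≡ k₁
    c₂-part = solve (k₁ ∷ k₂ ∷ k₃ ∷ [])
    v-part : ∀ E → k₁ * E + k₂ * m₁ + k₃ * + 0 - (k₁ * + 1 + k₂ * + 0 + k₃ * + 0) * E ≡ k₂ * m₁
    v-part E = solve (E ∷ k₁ ∷ k₂ ∷ k₃ ∷ m₁ ∷ [])
    w-part : ∀ E →
      k₁ * lam + k₂ * - (μ₂ * m₁) + k₃ * (m₁ * m₂) - (k₁ * + 1 + k₂ * + 0 + k₃ * + 0) * lam
        + μ₂ * (k₁ * E + k₂ * m₁ + k₃ * + 0 - (k₁ * + 1 + k₂ * + 0 + k₃ * + 0) * E)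
      ≡ k₃ * (m₁ * m₂)
    w-part E = solve (E ∷ k₁ ∷ k₂ ∷ k₃ ∷ lam ∷ μ₂ ∷ m₁ ∷ m₂ ∷ [])

  normalBasis-reconstruct : ∀ {x} q₂ q₃ → vPart F μ₁ x ≡ q₂ * m₁ → wPart F μ₁ μ₂ lam x ≡ q₃ * (m₁ * m₂) →
                            x ≡ lincomb (c₂ x) q₂ q₃ nb
  normalBasis-reconstruct {⟨ x₀ , x₁ , x₂ ⟩} q₂ q₃ v≡ w≡ =
    ⟨⟩-cong (c₀≡ (μ₁ + a₁ F) v≡ w≡) (c₁≡ (μ₁ + a₁ F) v≡) c₂≡
    where
    open ≡-Reasoning
    c₀≡ : ∀ E → x₁ - x₂ * E ≡ q₂ * m₁ → x₀ - x₂ * lam + μ₂ * (x₁ - x₂ * E) ≡ q₃ * (m₁ * m₂) →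
          x₀ ≡ x₂ * lam + q₂ * - (μ₂ * m₁) + q₃ * (m₁ * m₂)
    c₀≡ E v≡ w≡ = begin
      x₀
        ≡⟨ solve (x₀ ∷ x₁ ∷ x₂ ∷ E ∷ lam ∷ μ₂ ∷ []) ⟩
      x₂ * lam - μ₂ * (x₁ - x₂ * E) + (x₀ - x₂ * lam + μ₂ * (x₁ - x₂ * E))
        ≡⟨ cong₂ (λ v w → x₂ * lam - μ₂ * v + w) v≡ w≡ ⟩
      x₂ * lam - μ₂ * (q₂ * m₁) + q₃ * (m₁ * m₂)
        ≡⟨ solve (x₂ ∷ lam ∷ μ₂ ∷ q₂ ∷ m₁ ∷ q₃ ∷ m₂ ∷ []) ⟩
      x₂ * lam + q₂ * - (μ₂ * m₁) + q₃ * (m₁ * m₂)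
        ∎
    c₁≡ : ∀ E → x₁ - x₂ * E ≡ q₂ * m₁ → x₁ ≡ x₂ * E + q₂ * m₁ + q₃ * + 0
    c₁≡ E v≡ = begin
      x₁                                 ≡⟨ solve (x₁ ∷ x₂ ∷ E ∷ q₃ ∷ []) ⟩
      x₂ * E + (x₁ - x₂ * E) + q₃ * + 0  ≡⟨ cong (λ v → x₂ * E + v + q₃ * + 0) v≡ ⟩
      x₂ * E + q₂ * m₁ + q₃ * + 0        ∎
    c₂≡ : x₂ ≡ x₂ * + 1 + q₂ * + 0 + q₃ * + 0
    c₂≡ = solve (x₂ ∷ q₂ ∷ q₃ ∷ [])

  normalBasis-spans : ∀ x → (Σ ℤ λ k₁ → Σ ℤ λ k₂ → Σ ℤ λ k₃ → x ≡ lincomb k₁ k₂ k₃ nb) ⇔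
                            InNormalLattice F μ₁ μ₂ lam m₁ m₂ x
  normalBasis-spans x = mk⇔ to from
    where
    to : ∀ {y} → (Σ ℤ λ k₁ → Σ ℤ λ k₂ → Σ ℤ λ k₃ → y ≡ lincomb k₁ k₂ k₃ nb) →
         InNormalLattice F μ₁ μ₂ lam m₁ m₂ y
    to (k₁ , k₂ , k₃ , refl) with lincomb-normalBasis-parts k₁ k₂ k₃
    ... | _ , v≡ , w≡ = parts-divisible (divides k₂ v≡) (divides k₃ w≡)
    from : InNormalLattice F μ₁ μ₂ lam m₁ m₂ x →
           Σ ℤ λ k₁ → Σ ℤ λ k₂ → Σ ℤ λ k₃ → x ≡ lincomb k₁ k₂ k₃ nb
    from (parts-divisible (divides q₂ v≡) (divides q₃ w≡)) =
      c₂ x , q₂ , q₃ , normalBasis-reconstruct q₂ q₃ v≡ w≡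

  normalBasis-independent : m₁ ≢ + 0 → m₂ ≢ + 0 → ∀ k₁ k₂ k₃ → lincomb k₁ k₂ k₃ nb ≡ zeroE →
                            k₁ ≡ + 0 × k₂ ≡ + 0 × k₃ ≡ + 0
  normalBasis-independent m₁≢0 m₂≢0 k₁ k₂ k₃ eq with lincomb-normalBasis-parts k₁ k₂ k₃
  ... | c₂≡ , v≡ , w≡ =
    trans (sym c₂≡) (cong c₂ eq) ,
    i*j≡0∧j≢0⇒i≡0 (trans (sym v≡) (trans (cong (vPart F μ₁) eq) vPart-zeroE)) m₁≢0 ,
    i*j≡0∧j≢0⇒i≡0 (trans (sym w≡) (trans (cong (wPart F μ₁ μ₂ lam) eq) wPart-zeroE))
                  (i≢0∧j≢0⇒i*j≢0 m₁≢0 m₂≢0)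
    where
    vPart-zeroE : vPart F μ₁ zeroE ≡ + 0
    vPart-zeroE = cong (_-_ (+ 0)) (ℤ.*-zeroˡ (μ₁ + a₁ F))
    wPart-zeroE : wPart F μ₁ μ₂ lam zeroE ≡ + 0
    wPart-zeroE = trans (cong₂ (λ a b → + 0 - a + μ₂ * b) (ℤ.*-zeroˡ lam) vPart-zeroE)
                        (trans (ℤ.+-identityˡ _) (ℤ.*-zeroʳ μ₂))

  normalBasis-membership : ∀ {P} → IsZBasis P nb → ∀ x → P x ⇔ InNormalLattice F μ₁ μ₂ lam m₁ m₂ x
  normalBasis-membership (spans , _) x = ⇔.trans (spans x) (normalBasis-spans x)

  membership⇒normalBasis : ∀ {P} → m₁ ≢ + 0 → m₂ ≢ + 0 →
                           (∀ x → P x ⇔ InNormalLattice F μ₁ μ₂ lam m₁ m₂ x) → IsZBasis P nb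
  membership⇒normalBasis m₁≢0 m₂≢0 P⇔ =
    (λ x → ⇔.trans (P⇔ x) (⇔.sym (normalBasis-spans x))) , normalBasis-independent m₁≢0 m₂≢0

  -- Column operations turn the first column of the coordinate matrix into the wParts of the rows.
  normalBasis-∣-norm : ∀ {P N} → IsZBasis P nb → HasNorm P N → m₁ * m₂ ∣ + N
  normalBasis-∣-norm {P} basis ([ x , y , z ] , basis′ , ∣det∣≡N) =
    subst (λ n → m₁ * m₂ ∣ + n) ∣det∣≡N (∣-trans m₁m₂∣det m∣∣m∣)
    where
    b : ℤ
    b = - (lam + μ₂ * (μ₁ + a₁ F))
    shear : Elt → Elt
    shear = addToFirstColumn μ₂ b
    wPart≡ : ∀ v₀ v₁ v₂ E → v₀ - v₂ * lam + μ₂ * (v₁ - v₂ * E) ≡ v₀ + μ₂ * v₁ + - (lam + μ₂ * E) * v₂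
    wPart≡ v₀ v₁ v₂ E = solve (v₀ ∷ v₁ ∷ v₂ ∷ E ∷ lam ∷ μ₂ ∷ [])
    m₁m₂∣shear₀ : ∀ {v} → P v → m₁ * m₂ ∣ c₀ (shear v)
    m₁m₂∣shear₀ {v} v∈P = subst (m₁ * m₂ ∣_) (wPart≡ (c₀ v) (c₁ v) (c₂ v) (μ₁ + a₁ F))
      (InNormalLattice.m₁m₂∣wPart (Equivalence.to (normalBasis-membership basis v) v∈P))
    m₁m₂∣det : m₁ * m₂ ∣ det [ x , y , z ]
    m₁m₂∣det with basis-members basis′
    ... | x∈P , y∈P , z∈P = subst (m₁ * m₂ ∣_) (det-addToFirstColumn μ₂ b x y z)
      (∣column₀⇒∣det {x = shear x} {shear y} {shear z}
                     (m₁m₂∣shear₀ x∈P) (m₁m₂∣shear₀ y∈P) (m₁m₂∣shear₀ z∈P))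

vPart-shift : ∀ F μ₁ μ₁′ x → vPart F μ₁′ x ≡ vPart F μ₁ x - c₂ x * (μ₁′ - μ₁)
vPart-shift F μ₁ μ₁′ x = shift (c₁ x) (c₂ x) (a₁ F)
  where
  shift : ∀ x₁ x₂ e → x₁ - x₂ * (μ₁′ + e) ≡ x₁ - x₂ * (μ₁ + e) - x₂ * (μ₁′ - μ₁)
  shift x₁ x₂ e = solve (x₁ ∷ x₂ ∷ e ∷ μ₁ ∷ μ₁′ ∷ [])

wPart-shift : ∀ F μ₁ μ₂ lam μ₁′ μ₂′ lam′ x →
  wPart F μ₁′ μ₂′ lam′ x ≡
  wPart F μ₁ μ₂ lam x - c₂ x * (lam′ - (lam + μ₂′ * (μ₁ - μ₁′))) + vPart F μ₁ x * (μ₂′ - μ₂)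
wPart-shift F μ₁ μ₂ lam μ₁′ μ₂′ lam′ x = shift (c₀ x) (c₁ x) (c₂ x) (a₁ F)
  where
  shift : ∀ x₀ x₁ x₂ e →
    x₀ - x₂ * lam′ + μ₂′ * (x₁ - x₂ * (μ₁′ + e)) ≡
    x₀ - x₂ * lam + μ₂ * (x₁ - x₂ * (μ₁ + e)) - x₂ * (lam′ - (lam + μ₂′ * (μ₁ - μ₁′)))
      + (x₁ - x₂ * (μ₁ + e)) * (μ₂′ - μ₂)
  shift x₀ x₁ x₂ e = solve (x₀ ∷ x₁ ∷ x₂ ∷ e ∷ μ₁ ∷ μ₂ ∷ lam ∷ μ₁′ ∷ μ₂′ ∷ lam′ ∷ [])

InNormalLattice-cong : ∀ {F μ₁ μ₂ lam μ₁′ μ₂′ lam′ m₁ m₂ x} →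
  m₁ ∣ μ₁′ - μ₁ → m₂ ∣ μ₂′ - μ₂ → m₁ * m₂ ∣ lam′ - (lam + μ₂′ * (μ₁ - μ₁′)) →
  InNormalLattice F μ₁ μ₂ lam m₁ m₂ x ⇔ InNormalLattice F μ₁′ μ₂′ lam′ m₁ m₂ x
InNormalLattice-cong {F} {μ₁} {μ₂} {lam} {μ₁′} {μ₂′} {lam′} {m₁} {m₂} {x} m₁∣δμ₁ m₂∣δμ₂ m₁m₂∣δlam =
  mk⇔ to from
  where
  v-shift : vPart F μ₁′ x ≡ vPart F μ₁ x - c₂ x * (μ₁′ - μ₁)
  v-shift = vPart-shift F μ₁ μ₁′ x
  w-shift : wPart F μ₁′ μ₂′ lam′ x ≡
            wPart F μ₁ μ₂ lam x - c₂ x * (lam′ - (lam + μ₂′ * (μ₁ - μ₁′))) + vPart F μ₁ x * (μ₂′ - μ₂)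
  w-shift = wPart-shift F μ₁ μ₂ lam μ₁′ μ₂′ lam′ x
  to : InNormalLattice F μ₁ μ₂ lam m₁ m₂ x → InNormalLattice F μ₁′ μ₂′ lam′ m₁ m₂ x
  to (parts-divisible m₁∣v m₁m₂∣w) = parts-divisible
    (subst (m₁ ∣_) (sym v-shift) (∣m∣n⇒∣m-n m₁∣v (∣n⇒∣m*n (c₂ x) m₁∣δμ₁)))
    (subst (m₁ * m₂ ∣_) (sym w-shift)
      (∣m∣n⇒∣m+n (∣m∣n⇒∣m-n m₁m₂∣w (∣n⇒∣m*n (c₂ x) m₁m₂∣δlam)) (*-pres-∣ m₁∣v m₂∣δμ₂)))
  from : InNormalLattice F μ₁′ μ₂′ lam′ m₁ m₂ x → InNormalLattice F μ₁ μ₂ lam m₁ m₂ x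
  from (parts-divisible m₁∣v′ m₁m₂∣w′) = parts-divisible m₁∣v
    (∣m+n∣n⇒∣m (∣m+n∣n⇒∣m (subst (m₁ * m₂ ∣_) w-shift m₁m₂∣w′) (*-pres-∣ m₁∣v m₂∣δμ₂))
               (∣m⇒∣-m (∣n⇒∣m*n (c₂ x) m₁m₂∣δlam)))
    where
    m₁∣v : m₁ ∣ vPart F μ₁ x
    m₁∣v = ∣m+n∣n⇒∣m (subst (m₁ ∣_) v-shift m₁∣v′) (∣m⇒∣-m (∣n⇒∣m*n (c₂ x) m₁∣δμ₁))

InNormalLattice-crt : ∀ {F μ₁ μ₂ lam m₁ m₂ n₁ n₂ x} s t → s * (m₁ * m₂) + t * (n₁ * n₂) ≡ + 1 →
  InNormalLattice F μ₁ μ₂ lam (m₁ * n₁) (m₂ * n₂) x ⇔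
  (InNormalLattice F μ₁ μ₂ lam m₁ m₂ x × InNormalLattice F μ₁ μ₂ lam n₁ n₂ x)
InNormalLattice-crt {F} {μ₁} {μ₂} {lam} {m₁} {m₂} {n₁} {n₂} {x} s t bézout = mk⇔ to from
  where
  In : ℤ → ℤ → Set
  In k l = InNormalLattice F μ₁ μ₂ lam k l x
  m₁∣m₁n₁ : m₁ ∣ m₁ * n₁
  m₁∣m₁n₁ = ∣m⇒∣m*n n₁ ∣-refl
  m₂∣m₂n₂ : m₂ ∣ m₂ * n₂
  m₂∣m₂n₂ = ∣m⇒∣m*n n₂ ∣-refl
  n₁∣m₁n₁ : n₁ ∣ m₁ * n₁
  n₁∣m₁n₁ = ∣n⇒∣m*n m₁ ∣-refl
  n₂∣m₂n₂ : n₂ ∣ m₂ * n₂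
  n₂∣m₂n₂ = ∣n⇒∣m*n m₂ ∣-refl
  to : In (m₁ * n₁) (m₂ * n₂) → In m₁ m₂ × In n₁ n₂
  to (parts-divisible mn₁∣v mn₁mn₂∣w) =
    parts-divisible (∣-trans m₁∣m₁n₁ mn₁∣v) (∣-trans (*-pres-∣ m₁∣m₁n₁ m₂∣m₂n₂) mn₁mn₂∣w) ,
    parts-divisible (∣-trans n₁∣m₁n₁ mn₁∣v) (∣-trans (*-pres-∣ n₁∣m₁n₁ n₂∣m₂n₂) mn₁mn₂∣w)
  regroup : s * m₂ * m₁ + t * n₂ * n₁ ≡ s * (m₁ * m₂) + t * (n₁ * n₂)
  regroup = solve (s ∷ m₁ ∷ m₂ ∷ t ∷ n₁ ∷ n₂ ∷ [])
  rearrange : m₁ * m₂ * (n₁ * n₂) ≡ m₁ * n₁ * (m₂ * n₂)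
  rearrange = solve (m₁ ∷ m₂ ∷ n₁ ∷ n₂ ∷ [])
  from : In m₁ m₂ × In n₁ n₂ → In (m₁ * n₁) (m₂ * n₂)
  from (parts-divisible m₁∣v m₁m₂∣w , parts-divisible n₁∣v n₁n₂∣w) = parts-divisible
    (bézout⇒∣m∣n⇒∣m*n (s * m₂) (t * n₂) (trans regroup bézout) m₁∣v n₁∣v)
    (subst (_∣ wPart F μ₁ μ₂ lam x) rearrange (bézout⇒∣m∣n⇒∣m*n s t bézout m₁m₂∣w n₁n₂∣w))

ProductIdeal-normalForm :
  ∀ {F I J m₁ m₂ n₁ n₂ μ₁ μ₂ ν₁ ν₂ lam lam′} μ̃₁ μ̃₂ → IsIdeal F I → IsIdeal F J →
  m₁ * n₁ ≢ + 0 → m₂ * n₂ ≢ + 0 →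
  IsZBasis I (normalBasis F μ₁ μ₂ lam m₁ m₂) → IsZBasis J (normalBasis F ν₁ ν₂ lam′ n₁ n₂) →
  m₁ ∣ μ̃₁ - μ₁ → n₁ ∣ μ̃₁ - ν₁ → m₂ ∣ μ̃₂ - μ₂ → n₂ ∣ μ̃₂ - ν₂ →
  (Σ ℤ λ s → Σ ℤ λ t → s * (m₁ * m₂) + t * (n₁ * n₂) ≡ + 1) →
  ¬ DivisibleByRationalInteger (ProductIdeal F I J) ×
  Σ ℤ (λ lam~ → IsZBasis (ProductIdeal F I J) (normalBasis F μ̃₁ μ̃₂ lam~ (m₁ * n₁) (m₂ * n₂)))
ProductIdeal-normalForm {F} {I} {J} {m₁} {m₂} {n₁} {n₂} {μ₁} {μ₂} {ν₁} {ν₂} {lam} {lam′} μ̃₁ μ̃₂ isI isJ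
  m₁n₁≢0 m₂n₂≢0 basisI basisJ m₁∣δμ₁ n₁∣δν₁ m₂∣δμ₂ n₂∣δν₂ (s , t , bézout) =
  ∋c₂≡1⇒¬Divisible (proj₁ (basis-members basisIJ)) refl , L , basisIJ
  where
  L : ℤ
  L = crt s t (m₁ * m₂) (n₁ * n₂) (lam + μ̃₂ * (μ₁ - μ̃₁)) (lam′ + μ̃₂ * (ν₁ - μ̃₁))
  IJ⇔ : ∀ x → ProductIdeal F I J x ⇔ InNormalLattice F μ̃₁ μ̃₂ L (m₁ * n₁) (m₂ * n₂) x
  IJ⇔ x = begin
    ProductIdeal F I J x
      ≈⟨ ProductIdeal⇔∩ isI isJ s t (proj₂ (proj₂ (basis-members basisI)))
                                    (proj₂ (proj₂ (basis-members basisJ))) bézout x ⟩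
    (I x × J x)
      ≈⟨ normalBasis-membership F μ₁ μ₂ lam m₁ m₂ basisI x
         ×-⇔ normalBasis-membership F ν₁ ν₂ lam′ n₁ n₂ basisJ x ⟩
    (InNormalLattice F μ₁ μ₂ lam m₁ m₂ x × InNormalLattice F ν₁ ν₂ lam′ n₁ n₂ x)
      ≈⟨ InNormalLattice-cong m₁∣δμ₁ m₂∣δμ₂ (crt≡ˡ s t _ _ bézout)
         ×-⇔ InNormalLattice-cong n₁∣δν₁ n₂∣δν₂ (crt≡ʳ s t _ _ bézout) ⟩
    (InNormalLattice F μ̃₁ μ̃₂ L m₁ m₂ x × InNormalLattice F μ̃₁ μ̃₂ L n₁ n₂ x)
      ≈⟨ ⇔.sym (InNormalLattice-crt s t bézout) ⟩
    InNormalLattice F μ̃₁ μ̃₂ L (m₁ * n₁) (m₂ * n₂) x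
      ∎
    where open SetoidReasoning (⇔.⇔-setoid 0ℓ)
  basisIJ : IsZBasis (ProductIdeal F I J) (normalBasis F μ̃₁ μ̃₂ L (m₁ * n₁) (m₂ * n₂))
  basisIJ = membership⇒normalBasis F μ̃₁ μ̃₂ L (m₁ * n₁) (m₂ * n₂) m₁n₁≢0 m₂n₂≢0 IJ⇔

lemma6 : (F : Cubic) → Irreducible F →
         (I J : Subset) → IsIdeal F I → IsIdeal F J →
         NonzeroIdeal I → NonzeroIdeal J →
         ¬ DivisibleByRationalInteger I → ¬ DivisibleByRationalInteger J →
         (NI NJ : ℕ) → HasNorm I NI → HasNorm J NJ → gcd NI NJ ≡ 1 →
         (m₁ m₂ n₁ n₂ μ₁ μ₂ ν₁ ν₂ lam lam' : ℤ) →
         + 0 < m₁ → + 0 < m₂ → + 0 < n₁ → + 0 < n₂ →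
         evalF F μ₁ ≡ + 0 [mod m₁ ] → evalF F μ₂ ≡ + 0 [mod m₂ ] →
         evalF F ν₁ ≡ + 0 [mod n₁ ] → evalF F ν₂ ≡ + 0 [mod n₂ ] →
         IsZBasis I (normalBasis F μ₁ μ₂ lam m₁ m₂) →
         IsZBasis J (normalBasis F ν₁ ν₂ lam' n₁ n₂) →
         (μ̃₁ μ̃₂ : ℤ) →
         μ̃₁ ≡ μ₁ [mod m₁ ] → μ̃₁ ≡ ν₁ [mod n₁ ] →
         μ̃₂ ≡ μ₂ [mod m₂ ] → μ̃₂ ≡ ν₂ [mod n₂ ] →
         ¬ DivisibleByRationalInteger (ProductIdeal F I J)
         × Σ ℤ (λ lam~ → IsZBasis (ProductIdeal F I J)
               (normalBasis F μ̃₁ μ̃₂ lam~ (m₁ * n₁) (m₂ * n₂)))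
lemma6 F _ I J isI isJ _ _ _ _ NI NJ normI normJ gcd≡1 m₁ m₂ n₁ n₂ μ₁ μ₂ ν₁ ν₂ lam lam′
       0<m₁ 0<m₂ 0<n₁ 0<n₂ _ _ _ _ basisI basisJ μ̃₁ μ̃₂ μ̃₁≡μ₁ μ̃₁≡ν₁ μ̃₂≡μ₂ μ̃₂≡ν₂ =
  ProductIdeal-normalForm μ̃₁ μ̃₂ isI isJ (0<∧0<⇒*≢0 0<m₁ 0<n₁) (0<∧0<⇒*≢0 0<m₂ 0<n₂) basisI basisJ
    (∣ᵤ⇒∣ μ̃₁≡μ₁) (∣ᵤ⇒∣ μ̃₁≡ν₁) (∣ᵤ⇒∣ μ̃₂≡μ₂) (∣ᵤ⇒∣ μ̃₂≡ν₂)
    (bézout-∣ (bézout-ℤ gcd≡1) (normalBasis-∣-norm F μ₁ μ₂ lam m₁ m₂ basisI normI)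
                               (normalBasis-∣-norm F ν₁ ν₂ lam′ n₁ n₂ basisJ normJ))
  where
  0<∧0<⇒*≢0 : ∀ {i j} → + 0 < i → + 0 < j → i * j ≢ + 0
  0<∧0<⇒*≢0 0<i 0<j = i≢0∧j≢0⇒i*j≢0 (≢-sym (ℤ.<⇒≢ 0<i)) (≢-sym (ℤ.<⇒≢ 0<j))
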